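{- For every $G\in\mathcal{C}^*_k$, $\vee(\widehat G)\cong G$ as colored graphs. In particular, the map $G\mapsto\widehat G$ is injective on isomorphism types of $\mathcal{C}^*_k$.
   Context: Fix pointed finite graphs $(G_i,a_i)_{i\in\mathbb{N}}$ such that each $G_i$ is 2-connected, $\{G_i\}$ is an antichain under induced embeddability, and no automorphism of any $G_i$ moves $a_i$. A copy of $G_i$ in a graph is an induced subgraph isomorphic to $G_i$; its basepoint is the image of $a_i$ (well defined since no automorphism moves $a_i$); the copy is free over its basepoint if no vertex of it other than the basepoint has a neighbor outside the copy. $\mathcal{C}_k$ is the class of finite graphs with $k$ unary predicates (colors $1,\dots,k$); $\mathcal{C}^*_k$ consists of those in which every vertex has exactly one color and which contain no copy of any $G_i$. For $G\in\mathcal{C}^*_k$, $\widehat G$ is obtained by, for each vertex $v$ of color $i$, freely attaching a new copy of $G_i$ with $a_i$ identified with $v$. For a graph $H$, $\vee(H)\in\mathcal{C}_k$ is the colored graph whose vertices are the basepoints of copies of $G_i$ ($1\le i\le k$) in $H$ that are free over their basepoints, each such basepoint receiving color $i$ for each such copy of $G_i$ it is the basepoint of, with edges induced from $H$. -}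

module Defs where

open import Data.Nat using (ℕ)
open import Data.Fin using (Fin; toℕ)
open import Data.Bool using (Bool; true; false; T)
open import Data.Bool.Properties using (T-irrelevant)
open import Data.Empty using (⊥)
open import Data.Unit using (tt)
open import Data.Product using (Σ; ∃; ∃-syntax; _×_; _,_; proj₁; proj₂)
open import Data.Sum using (_⊎_; inj₁; inj₂)
import Data.Sum.Properties as SumP
import Data.Product.Properties as ProdP
open import Function.Bundles using (_⇔_; _↔_)
open import Relation.Nullary using (¬_; yes; no)
open import Relation.Nullary.Decidable using (False)
open import Relation.Binary.Definitions using (DecidableEquality)
open import Relation.Binary.PropositionalEquality using (_≡_; _≢_; refl)

-- Simplicity (symmetric, irreflexive) and finiteness
-- are separate predicates, imposed as hypotheses where the paper does.

record Graph : Set₁ where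
  field
    V    : Set
    Adj  : V → V → Set
    _≟_  : DecidableEquality V

open Graph public

record IsFiniteSimple (G : Graph) : Set where
  field
    symm   : ∀ u v → Adj G u v → Adj G v u
    irrefl : ∀ v → ¬ Adj G v v
    size   : ℕ
    enum   : V G ↔ Fin size

record Embedding (H G : Graph) : Set where
  field
    map  : V H → V G
    inj  : ∀ u v → map u ≡ map v → u ≡ v
    adj  : ∀ u v → Adj H u v ⇔ Adj G (map u) (map v)

open Embedding public

record Iso (G H : Graph) : Set where
  field
    to    : V G → V H
    from  : V H → V G
    to-from : ∀ y → to (from y) ≡ y
    from-to : ∀ x → from (to x) ≡ x
    adj   : ∀ u v → Adj G u v ⇔ Adj H (to u) (to v)

-- walks in G all of whose vertices after the first avoid the predicate Bad
data WalkAvoiding (G : Graph) (Bad : V G → Set) : V G → V G → Set where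
  []  : ∀ {v} → WalkAvoiding G Bad v v
  _∷_ : ∀ {u w v} → Adj G u w × ¬ Bad w → WalkAvoiding G Bad w v →
        WalkAvoiding G Bad u v

NoBad : (G : Graph) → V G → Set
NoBad G _ = ⊥

Connected : Graph → Set
Connected G = ∀ u v → WalkAvoiding G (NoBad G) u v

TwoConnected : Graph → Set
TwoConnected G =
  (Σ (V G) λ x → Σ (V G) λ y → Σ (V G) λ z → (x ≢ y × y ≢ z × x ≢ z))
  × Connected G
  × (∀ x u v → u ≢ x → v ≢ x → WalkAvoiding G (λ w → w ≡ x) u v)

record PGraph : Set₁ where
  field
    gr   : Graph
    base : V gr

open PGraph public

BaseRigid : PGraph → Set
BaseRigid P = (σ : Iso (gr P) (gr P)) → Iso.to σ (base P) ≡ base P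

record GoodFamily (𝒢 : ℕ → PGraph) : Set₁ where
  field
    finiteSimple : ∀ i → IsFiniteSimple (gr (𝒢 i))
    twoConn      : ∀ i → TwoConnected (gr (𝒢 i))
    antichain    : ∀ i j → i ≢ j → ¬ Embedding (gr (𝒢 i)) (gr (𝒢 j))
    rigid        : ∀ i → BaseRigid (𝒢 i)

HasCopy : (𝒢 : ℕ → PGraph) → ℕ → Graph → Set
HasCopy 𝒢 i H = Embedding (gr (𝒢 i)) H

FreeCopyAt : (𝒢 : ℕ → PGraph) → ℕ → (H : Graph) → V H → Set
FreeCopyAt 𝒢 i H v =
  Σ (Embedding (gr (𝒢 i)) H) λ f →
    (map f (base (𝒢 i)) ≡ v) ×
    (∀ x → x ≢ base (𝒢 i) → ∀ w → Adj H (map f x) w → ∃[ y ] map f y ≡ w)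

-- Colored graphs (class C_k): a graph with k unary predicates.
-- Color j : Fin k corresponds to the graph 𝒢 (toℕ j).

record CGraph (k : ℕ) : Set₁ where
  field
    graph : Graph
    Col   : V graph → Fin k → Set

open CGraph public

ExactlyOneColor : ∀ {k} → CGraph k → Set
ExactlyOneColor {k} G =
  ∀ v → Σ (Fin k) λ j → Col G v j × (∀ j′ → Col G v j′ → j′ ≡ j)

record InCStar {k : ℕ} (𝒢 : ℕ → PGraph) (G : CGraph k) : Set where
  field
    finiteSimple : IsFiniteSimple (graph G)
    oneColor     : ExactlyOneColor G
    noCopy       : ∀ i → ¬ HasCopy 𝒢 i (graph G)

record CIso {k : ℕ} (G H : CGraph k) : Set where
  field
    iso : Iso (graph G) (graph H)
    col : ∀ v j → Col G v j ⇔ Col H (Iso.to iso v) j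

private
  T-dec : ∀ b → DecidableEquality (T b)
  T-dec true tt tt = yes refl

module Hat {k : ℕ} (𝒢 : ℕ → PGraph) (G : CGraph k) (one : ExactlyOneColor G) where
  c : V (graph G) → Fin k
  c v = proj₁ (one v)

  P : V (graph G) → PGraph
  P v = 𝒢 (toℕ (c v))

  -- non-basepoint vertices of the copy attached at v
  Extra : V (graph G) → Set
  Extra v = Σ (V (gr (P v))) λ x → False (_≟_ (gr (P v)) x (base (P v)))

  HV : Set
  HV = V (graph G) ⊎ Σ (V (graph G)) Extra

  HAdj : HV → HV → Set
  HAdj (inj₁ u) (inj₁ w) = Adj (graph G) u w
  HAdj (inj₁ u) (inj₂ (v , x , _)) = (u ≡ v) × Adj (gr (P v)) (base (P v)) x
  HAdj (inj₂ (v , x , _)) (inj₁ u) = (v ≡ u) × Adj (gr (P v)) x (base (P v))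
  HAdj (inj₂ (v , x , _)) (inj₂ (w , y , _)) with _≟_ (graph G) v w
  ... | yes refl = Adj (gr (P v)) x y
  ... | no _ = ⊥

  HDec : DecidableEquality HV
  HDec = SumP.≡-dec (_≟_ (graph G))
           (ProdP.≡-dec (_≟_ (graph G))
             (λ {v} → ProdP.≡-dec (_≟_ (gr (P v))) (λ {x} → T-dec _)))

  hat : Graph
  hat = record { V = HV ; Adj = HAdj ; _≟_ = HDec }

hat : ∀ {k} (𝒢 : ℕ → PGraph) (G : CGraph k) → ExactlyOneColor G → Graph
hat 𝒢 G one = Hat.hat 𝒢 G one

-- The construction H ↦ ∨(H).  Its vertex set is a subset of V H, so we
-- present it as H together with a membership predicate; colors and
-- edges are induced from H.

record SubCGraph (k : ℕ) : Set₁ where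
  field
    host : Graph
    Mem  : V host → Set
    SCol : V host → Fin k → Set

vee : ∀ {k} (𝒢 : ℕ → PGraph) → Graph → SubCGraph k
vee {k} 𝒢 H = record
  { host = H
  ; Mem  = λ v → ∃[ j ] FreeCopyAt 𝒢 (toℕ {k} j) H v
  ; SCol = λ v j → FreeCopyAt 𝒢 (toℕ j) H v
  }

record SubCIso {k : ℕ} (S : SubCGraph k) (G : CGraph k) : Set where
  open SubCGraph S
  field
    from    : V (graph G) → V host
    from-mem : ∀ v → Mem (from v)
    from-inj : ∀ u v → from u ≡ from v → u ≡ v
    from-surj : ∀ w → Mem w → ∃[ v ] from v ≡ w
    adj : ∀ u v → Adj (graph G) u v ⇔ Adj host (from u) (from v)
    col : ∀ v j → Col G v j ⇔ SCol (from v) j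

module Submission where

-- Each vertex v of G is, in Ĝ, the basepoint of the copy of G_c(v) attached
-- to it, and that copy is free. Conversely, a copy of some G_i in Ĝ cannot lie
-- inside G, which contains no copy, so it meets an attached copy away from its
-- basepoint v. The attached copy meets the rest of Ĝ only in v, and deleting
-- the (at most one) vertex of G_i sent to v leaves G_i connected, so the whole
-- copy stays inside the attached one. Hence G_i embeds into G_c(v), so i = c(v)
-- by the antichain condition, and the basepoint goes to v by rigidity. Thus
-- ∨(Ĝ) is G with its colouring; and since isomorphisms carry free copies to
-- free copies, Ĝ ≅ Ĥ yields G ≅ ∨(Ĝ) ≅ ∨(Ĥ) ≅ H.

open import Defs
open import Data.Nat using (ℕ; zero; suc) renaming (_≟_ to _≟ℕ_)
open import Data.Nat.Properties using (n<1+n)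
open import Data.Fin using (Fin; toℕ; punchOut)
open import Data.Fin.Properties using (any?; pigeonhole; punchOut-injective; <⇒≢; toℕ-injective)
  renaming (_≟_ to _≟F_)
open import Data.Bool.Properties using (T-irrelevant)
open import Data.Empty using (⊥; ⊥-elim)
open import Data.Unit using (⊤; tt)
open import Data.Product using (∃; ∃-syntax; _×_; _,_; proj₁; proj₂)
open import Data.Sum using (_⊎_; inj₁; inj₂)
open import Data.Sum.Properties using (inj₁-injective)
open import Function.Bundles using (_⇔_; _↔_; mk⇔; Inverse; Equivalence)
open import Function.Construct.Identity using (⇔-id)
open import Function.Construct.Symmetry using (⇔-sym)
open import Function.Construct.Composition using () renaming (equivalence to infixr 5 _⟨⇔⟩_)
open import Relation.Binary.Definitions using (DecidableEquality)
open import Relation.Nullary using (¬_; yes; no; Dec)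
open import Relation.Nullary.Decidable using (False; fromWitnessFalse; toWitnessFalse)
open import Relation.Binary.PropositionalEquality
  using (_≡_; _≢_; refl; sym; trans; cong; subst; module ≡-Reasoning)
open ≡-Reasoning

Fin-injective⇒surjective : ∀ {n} (f : Fin n → Fin n) → (∀ a b → f a ≡ f b → a ≡ b) →
  ∀ y → ∃[ x ] f x ≡ y
Fin-injective⇒surjective {zero} f f-inj ()
Fin-injective⇒surjective {suc n} f f-inj y with any? (λ x → f x ≟F y)
... | yes hit = hit
... | no miss =
  let i , j , i<j , collide = pigeonhole (n<1+n n) (λ x → punchOut (avoids x))
  in ⊥-elim (<⇒≢ i<j (f-inj i j (punchOut-injective (avoids i) (avoids j) collide)))
  where
  avoids : ∀ x → y ≢ f x
  avoids x y≡fx = miss (x , sym y≡fx)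

module _ {A : Set} {n : ℕ} (enum : A ↔ Fin n) where
  private
    module E = Inverse enum

  finite-any? : (P : A → Set) → (∀ x → Dec (P x)) → Dec (∃ P)
  finite-any? P P? with any? (λ i → P? (E.from i))
  ... | yes (i , p) = yes (E.from i , p)
  ... | no none = no λ (x , p) → none (E.to x , subst P (sym (E.strictlyInverseʳ x)) p)

  finite-injective⇒surjective : (f : A → A) → (∀ a b → f a ≡ f b → a ≡ b) →
    ∀ y → ∃[ x ] f x ≡ y
  finite-injective⇒surjective f f-inj y =
    let i , gi≡y = Fin-injective⇒surjective g g-inj (E.to y)
    in E.from i , (begin
      f (E.from i)              ≡⟨ E.strictlyInverseʳ _ ⟨
      E.from (g i)              ≡⟨ cong E.from gi≡y ⟩
      E.from (E.to y)           ≡⟨ E.strictlyInverseʳ y ⟩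
      y                         ∎)
    where
    g : Fin n → Fin n
    g i = E.to (f (E.from i))
    g-inj : ∀ a b → g a ≡ g b → a ≡ b
    g-inj a b ga≡gb = begin
      a                 ≡⟨ E.strictlyInverseˡ a ⟨
      E.to (E.from a)   ≡⟨ cong E.to (f-inj _ _ (begin
        f (E.from a)          ≡⟨ E.strictlyInverseʳ _ ⟨
        E.from (g a)          ≡⟨ cong E.from ga≡gb ⟩
        E.from (g b)          ≡⟨ E.strictlyInverseʳ _ ⟩
        f (E.from b)          ∎)) ⟩
      E.to (E.from b)   ≡⟨ E.strictlyInverseˡ b ⟩
      b                 ∎

Adj-resp-≡ : ∀ (H : Graph) {a a′ b b′} → a ≡ a′ → b ≡ b′ → Adj H a b ⇔ Adj H a′ b′
Adj-resp-≡ H refl refl = ⇔-id _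

Iso-sym : ∀ {A B} → Iso A B → Iso B A
Iso-sym {B = B} φ = record
  { to = from ; from = to ; to-from = from-to ; from-to = to-from
  ; adj = λ u v → Adj-resp-≡ B (sym (to-from u)) (sym (to-from v))
                  ⟨⇔⟩ ⇔-sym (Iso.adj φ (from u) (from v))
  }
  where open Iso φ hiding (adj)

factor-through : ∀ {A B C} (g : Embedding B C) (f : Embedding A C) (h : V A → V B) →
  (∀ x → map g (h x) ≡ map f x) → Embedding A B
factor-through {C = C} g f h g∘h≡f = record
  { map = h
  ; inj = λ a b ha≡hb → inj f a b (trans (sym (g∘h≡f a)) (trans (cong (map g) ha≡hb) (g∘h≡f b)))
  ; adj = λ a b → adj f a b ⟨⇔⟩ Adj-resp-≡ C (sym (g∘h≡f a)) (sym (g∘h≡f b))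
                  ⟨⇔⟩ ⇔-sym (adj g (h a) (h b))
  }

finite-self-embedding⇒automorphism : ∀ {H} → IsFiniteSimple H → Embedding H H → Iso H H
finite-self-embedding⇒automorphism fs e = record
  { to = map e
  ; from = λ y → proj₁ (onto y)
  ; to-from = λ y → proj₂ (onto y)
  ; from-to = λ x → inj e _ _ (proj₂ (onto (map e x)))
  ; adj = adj e
  }
  where
  onto : ∀ y → ∃[ x ] map e x ≡ y
  onto = finite-injective⇒surjective (IsFiniteSimple.enum fs) (map e) (inj e)

family-embedding-rigid : ∀ {𝒢} → GoodFamily 𝒢 → ∀ {i j} (e : Embedding (gr (𝒢 i)) (gr (𝒢 j))) →
  (i ≡ j) × (map e (base (𝒢 i)) ≡ base (𝒢 j))
family-embedding-rigid good {i} {j} e with i ≟ℕ j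
... | no i≢j = ⊥-elim (GoodFamily.antichain good i j i≢j e)
... | yes refl = refl , GoodFamily.rigid good i
  (finite-self-embedding⇒automorphism (GoodFamily.finiteSimple good i) e)

WalkAvoiding-weaken : ∀ {G Bad Bad′ u v} → (∀ w → Bad′ w → Bad w) →
  WalkAvoiding G Bad u v → WalkAvoiding G Bad′ u v
WalkAvoiding-weaken weaker [] = []
WalkAvoiding-weaken weaker ((uw , ¬bad) ∷ walk) =
  (uw , λ bad′ → ¬bad (weaker _ bad′)) ∷ WalkAvoiding-weaken weaker walk

WalkAvoiding-preserves : ∀ {G Bad u v} (R : V G → Set) →
  (∀ {a b} → Adj G a b → ¬ Bad b → R a → R b) → WalkAvoiding G Bad u v → R u → R v
WalkAvoiding-preserves R step [] r = r
WalkAvoiding-preserves R step ((uw , ¬bad) ∷ walk) r =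
  WalkAvoiding-preserves R step walk (step uw ¬bad r)

walk-avoiding-subsingleton : ∀ {Q} → IsFiniteSimple Q → TwoConnected Q →
  (B : V Q → Set) → (∀ x → Dec (B x)) → (∀ {x y} → B x → B y → x ≡ y) →
  ∀ u v → ¬ B u → ¬ B v → WalkAvoiding Q B u v
walk-avoiding-subsingleton fs (_ , connected , avoiding) B B? B-unique u v ¬Bu ¬Bv
  with finite-any? (IsFiniteSimple.enum fs) B B?
... | yes (x , Bx) = WalkAvoiding-weaken (λ w Bw → B-unique Bw Bx)
  (avoiding x u v (λ u≡x → ¬Bu (subst B (sym u≡x) Bx)) (λ v≡x → ¬Bv (subst B (sym v≡x) Bx)))
... | no none = WalkAvoiding-weaken (λ w Bw → none (w , Bw)) (connected u v)

FreeCopyAt-transport : ∀ {𝒢 i A B} (φ : Iso A B) {a} →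
  FreeCopyAt 𝒢 i A a → FreeCopyAt 𝒢 i B (Iso.to φ a)
FreeCopyAt-transport {𝒢} {i} {B = B} φ (f , base↦a , free) = φ∘f , cong to base↦a , free′
  where
  open Iso φ
  φ∘f : Embedding (gr (𝒢 i)) B
  φ∘f = record
    { map = λ x → to (map f x)
    ; inj = λ a b e → inj f a b (trans (sym (from-to _)) (trans (cong from e) (from-to _)))
    ; adj = λ a b → adj f a b ⟨⇔⟩ Iso.adj φ _ _
    }
  free′ : ∀ x → x ≢ base (𝒢 i) → ∀ w → Adj B (map φ∘f x) w → ∃[ y ] map φ∘f y ≡ w
  free′ x x≢a w xw =
    let y , fy≡ = free x x≢a (from w)
                    (Equivalence.from (Iso.adj φ _ _) (subst (Adj B _) (sym (to-from w)) xw))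
    in y , trans (cong to fy≡) (to-from w)

FreeCopyAt-⇔ : ∀ {𝒢 i A B} (φ : Iso A B) {a} →
  FreeCopyAt 𝒢 i A a ⇔ FreeCopyAt 𝒢 i B (Iso.to φ a)
FreeCopyAt-⇔ {𝒢} {i} {A} φ {a} = mk⇔ (FreeCopyAt-transport {𝒢} {i} φ) λ free →
  subst (FreeCopyAt 𝒢 i A) (Iso.from-to φ a) (FreeCopyAt-transport {𝒢} {i} (Iso-sym φ) free)

module _ {k : ℕ} (𝒢 : ℕ → PGraph) where

  vee-transport : ∀ {A B : Graph} {G H : CGraph k} (φ : Iso A B)
    (α : SubCIso (vee 𝒢 A) G) (β : SubCIso (vee 𝒢 B) H) →
    ∀ v → ∃[ u ] SubCIso.from β u ≡ Iso.to φ (SubCIso.from α v)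
  vee-transport φ α β v =
    let j , free = SubCIso.from-mem α v
    in SubCIso.from-surj β _ (j , FreeCopyAt-transport {𝒢} {toℕ j} φ free)

  vee-iso⇒CIso : ∀ {A B : Graph} {G H : CGraph k} → Iso A B →
    SubCIso (vee 𝒢 A) G → SubCIso (vee 𝒢 B) H → CIso G H
  vee-iso⇒CIso {A} {B} {G} {H} φ α β = record
    { iso = record { to = to ; from = from ; to-from = to-from ; from-to = from-to ; adj = adj′ }
    ; col = col′
    }
    where
    module α = SubCIso α
    module β = SubCIso β
    module φ = Iso φ
    to : V (graph G) → V (graph H)
    to v = proj₁ (vee-transport φ α β v)
    to-spec : ∀ v → β.from (to v) ≡ φ.to (α.from v)
    to-spec v = proj₂ (vee-transport φ α β v)
    from : V (graph H) → V (graph G)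
    from u = proj₁ (vee-transport (Iso-sym φ) β α u)
    from-spec : ∀ u → α.from (from u) ≡ φ.from (β.from u)
    from-spec u = proj₂ (vee-transport (Iso-sym φ) β α u)
    to-from : ∀ u → to (from u) ≡ u
    to-from u = β.from-inj _ _ (begin
      β.from (to (from u))        ≡⟨ to-spec (from u) ⟩
      φ.to (α.from (from u))      ≡⟨ cong φ.to (from-spec u) ⟩
      φ.to (φ.from (β.from u))    ≡⟨ φ.to-from _ ⟩
      β.from u                    ∎)
    from-to : ∀ v → from (to v) ≡ v
    from-to v = α.from-inj _ _ (begin
      α.from (from (to v))        ≡⟨ from-spec (to v) ⟩
      φ.from (β.from (to v))      ≡⟨ cong φ.from (to-spec v) ⟩
      φ.from (φ.to (α.from v))    ≡⟨ φ.from-to _ ⟩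
      α.from v                    ∎)
    adj′ : ∀ u v → Adj (graph G) u v ⇔ Adj (graph H) (to u) (to v)
    adj′ u v = α.adj u v ⟨⇔⟩ φ.adj _ _ ⟨⇔⟩ Adj-resp-≡ B (sym (to-spec u)) (sym (to-spec v))
               ⟨⇔⟩ ⇔-sym (β.adj (to u) (to v))
    col′ : ∀ v j → Col G v j ⇔ Col H (to v) j
    col′ v j = α.col v j ⟨⇔⟩ FreeCopyAt-⇔ {𝒢} {toℕ j} φ
               ⟨⇔⟩ mk⇔ (subst Free (sym (to-spec v))) (subst Free (to-spec v))
               ⟨⇔⟩ ⇔-sym (β.col (to v) j)
      where
      Free : V B → Set
      Free = FreeCopyAt 𝒢 (toℕ j) B

module HatStructure {k : ℕ} (𝒢 : ℕ → PGraph) (good : GoodFamily 𝒢) (G : CGraph k)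
                    (hG : InCStar 𝒢 G) where
  open Hat 𝒢 G (InCStar.oneColor hG) using (c; P; HV; HAdj) renaming (hat to Ĝ)

  private
    VG : Set
    VG = V (graph G)
    _≟G_ : DecidableEquality VG
    _≟G_ = _≟_ (graph G)
    _≟Ĝ_ : DecidableEquality HV
    _≟Ĝ_ = _≟_ Ĝ
    one : ExactlyOneColor G
    one = InCStar.oneColor hG

  core : Embedding (graph G) Ĝ
  core = record { map = inj₁ ; inj = λ _ _ → inj₁-injective ; adj = λ u v → ⇔-id _ }

  attach-by : ∀ v x → Dec (x ≡ base (P v)) → HV
  attach-by v x (yes _) = inj₁ v
  attach-by v x (no x≢a) = inj₂ (v , x , fromWitnessFalse x≢a)

  attach : ∀ v → V (gr (P v)) → HV
  attach v x = attach-by v x (_≟_ (gr (P v)) x (base (P v)))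

  attach-base : ∀ v → attach v (base (P v)) ≡ inj₁ v
  attach-base v with _≟_ (gr (P v)) (base (P v)) (base (P v))
  ... | yes _ = refl
  ... | no a≢a = ⊥-elim (a≢a refl)

  attach-by-extra : ∀ v x dx (x≢a : False (_≟_ (gr (P v)) x (base (P v)))) →
    attach-by v x dx ≡ inj₂ (v , x , x≢a)
  attach-by-extra v x (yes x≡a) x≢a = ⊥-elim (toWitnessFalse x≢a x≡a)
  attach-by-extra v x (no _) x≢a = cong (λ p → inj₂ (v , x , p)) (T-irrelevant _ _)

  attach-extra : ∀ v x (x≢a : False (_≟_ (gr (P v)) x (base (P v)))) →
    attach v x ≡ inj₂ (v , x , x≢a)
  attach-extra v x = attach-by-extra v x _

  attach-by-injective : ∀ v x y dx dy → attach-by v x dx ≡ attach-by v y dy → x ≡ y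
  attach-by-injective v x y (yes x≡a) (yes y≡a) _ = trans x≡a (sym y≡a)
  attach-by-injective v x .x (no _) (no _) refl = refl

  attach-by-adj : ∀ v x y dx dy → Adj (gr (P v)) x y ⇔ HAdj (attach-by v x dx) (attach-by v y dy)
  attach-by-adj v x y (yes refl) (yes refl) = mk⇔
    (λ aa → ⊥-elim (IsFiniteSimple.irrefl (GoodFamily.finiteSimple good (toℕ (c v))) _ aa))
    (λ vv → ⊥-elim (IsFiniteSimple.irrefl (InCStar.finiteSimple hG) v vv))
  attach-by-adj v x y (yes refl) (no _) = mk⇔ (refl ,_) proj₂
  attach-by-adj v x y (no _) (yes refl) = mk⇔ (refl ,_) proj₂
  attach-by-adj v x y (no _) (no _) with v ≟G v
  ... | yes refl = ⇔-id _
  ... | no v≢v = ⊥-elim (v≢v refl)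

  attached : ∀ v → Embedding (gr (P v)) Ĝ
  attached v = record
    { map = attach v
    ; inj = λ x y → attach-by-injective v x y (dec x) (dec y)
    ; adj = λ x y → attach-by-adj v x y (dec x) (dec y)
    }
    where
    dec : ∀ x → Dec (x ≡ base (P v))
    dec x = _≟_ (gr (P v)) x (base (P v))

  extra-neighbour-attached : ∀ v x x≢a w → HAdj (inj₂ (v , x , x≢a)) w → ∃[ y ] attach v y ≡ w
  extra-neighbour-attached v x x≢a (inj₁ u) (refl , _) = base (P v) , attach-base v
  extra-neighbour-attached v x x≢a (inj₂ (u , y , y≢a)) xy with v ≟G u
  ... | yes refl = y , attach-extra v y y≢a

  attached-free : ∀ v → FreeCopyAt 𝒢 (toℕ (c v)) Ĝ (inj₁ v)
  attached-free v = attached v , attach-base v , λ x x≢a w xw →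
    extra-neighbour-attached v x (fromWitnessFalse x≢a) w
      (subst (λ h → HAdj h w) (attach-extra v x (fromWitnessFalse x≢a)) xw)

  owner : HV → VG
  owner (inj₁ v) = v
  owner (inj₂ (v , _)) = v

  IsExtra : HV → Set
  IsExtra (inj₁ _) = ⊥
  IsExtra (inj₂ _) = ⊤

  isExtra? : ∀ h → Dec (IsExtra h)
  isExtra? (inj₁ _) = no λ ()
  isExtra? (inj₂ _) = yes tt

  ¬extra⇒core : ∀ h → ¬ IsExtra h → inj₁ (owner h) ≡ h
  ¬extra⇒core (inj₁ _) _ = refl
  ¬extra⇒core (inj₂ _) ¬extra = ⊥-elim (¬extra tt)

  ExtraOf : VG → HV → Set
  ExtraOf v (inj₁ _) = ⊥
  ExtraOf v (inj₂ (u , _)) = u ≡ v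

  extra⇒extra-of-owner : ∀ {h} → IsExtra h → ExtraOf (owner h) h
  extra⇒extra-of-owner {inj₂ _} _ = refl

  extra-of⇒≢core : ∀ {v h} → ExtraOf v h → h ≢ inj₁ v
  extra-of⇒≢core {h = inj₂ _} _ ()

  extra-step : ∀ v {h h′} → HAdj h h′ → h′ ≢ inj₁ v → ExtraOf v h → ExtraOf v h′
  extra-step v {inj₂ (u , _)} {inj₁ w} (refl , _) h′≢v refl = ⊥-elim (h′≢v refl)
  extra-step v {inj₂ (u , _)} {inj₂ (w , _)} hh′ _ refl with v ≟G w
  ... | yes v≡w = sym v≡w

  InBlock : VG → HV → Set
  InBlock v h = (h ≡ inj₁ v) ⊎ ExtraOf v h

  block⇒attached : ∀ v h → InBlock v h → ∃[ x ] attach v x ≡ h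
  block⇒attached v h (inj₁ h≡v) = base (P v) , trans (attach-base v) (sym h≡v)
  block⇒attached v (inj₂ (.v , x , x≢a)) (inj₂ refl) = x , attach-extra v x x≢a

  module _ {i : ℕ} (f : Embedding (gr (𝒢 i)) Ĝ) where
    private
      Q : Graph
      Q = gr (𝒢 i)
      fsQ : IsFiniteSimple Q
      fsQ = GoodFamily.finiteSimple good i

    copy-meets-extra : ∃[ t ] IsExtra (map f t)
    copy-meets-extra
      with finite-any? (IsFiniteSimple.enum fsQ) (λ t → IsExtra (map f t)) (λ t → isExtra? (map f t))
    ... | yes hit = hit
    ... | no miss = ⊥-elim (InCStar.noCopy hG i
          (factor-through core f (λ t → owner (map f t)) (λ t → ¬extra⇒core (map f t) (λ e → miss (t , e)))))

    copy-within-block : ∀ {v t₀} → ExtraOf v (map f t₀) → ∀ t → InBlock v (map f t)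
    copy-within-block {v} {t₀} extra t with map f t ≟Ĝ inj₁ v
    ... | yes t↦v = inj₁ t↦v
    ... | no t↛v = inj₂ (WalkAvoiding-preserves (λ s → ExtraOf v (map f s)) step walk extra)
      where
      walk : WalkAvoiding Q (λ s → map f s ≡ inj₁ v) t₀ t
      walk = walk-avoiding-subsingleton fsQ (GoodFamily.twoConn good i) _ (λ s → map f s ≟Ĝ inj₁ v)
        (λ p q → inj f _ _ (trans p (sym q))) t₀ t (extra-of⇒≢core extra) t↛v
      step : ∀ {a b} → Adj Q a b → map f b ≢ inj₁ v → ExtraOf v (map f a) → ExtraOf v (map f b)
      step ab = extra-step v (Equivalence.to (adj f _ _) ab)

    copy-is-attached : ∃[ v ] (i ≡ toℕ (c v)) × (map f (base (𝒢 i)) ≡ inj₁ v)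
    copy-is-attached = v , proj₁ rigidity , (begin
      map f (base (𝒢 i))           ≡⟨ lift-spec _ ⟨
      attach v (lift (base (𝒢 i))) ≡⟨ cong (attach v) (proj₂ rigidity) ⟩
      attach v (base (P v))        ≡⟨ attach-base v ⟩
      inj₁ v                       ∎)
      where
      t₀ : V Q
      t₀ = proj₁ copy-meets-extra
      v : VG
      v = owner (map f t₀)
      in-block : ∀ t → InBlock v (map f t)
      in-block = copy-within-block (extra⇒extra-of-owner (proj₂ copy-meets-extra))
      lift : V Q → V (gr (P v))
      lift t = proj₁ (block⇒attached v _ (in-block t))
      lift-spec : ∀ t → attach v (lift t) ≡ map f t
      lift-spec t = proj₂ (block⇒attached v _ (in-block t))
      rigidity : (i ≡ toℕ (c v)) × (lift (base (𝒢 i)) ≡ base (P v))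
      rigidity = family-embedding-rigid good (factor-through (attached v) f lift lift-spec)

  colour⇔free-copy : ∀ v j → Col G v j ⇔ FreeCopyAt 𝒢 (toℕ j) Ĝ (inj₁ v)
  colour⇔free-copy v j = mk⇔ to from
    where
    to : Col G v j → FreeCopyAt 𝒢 (toℕ j) Ĝ (inj₁ v)
    to col with proj₂ (proj₂ (one v)) j col
    ... | refl = attached-free v
    from : FreeCopyAt 𝒢 (toℕ j) Ĝ (inj₁ v) → Col G v j
    from (f , base↦v , _) with copy-is-attached f
    ... | u , j≡cu , base↦u with inj₁-injective (trans (sym base↦u) base↦v)
    ...   | refl with toℕ-injective j≡cu
    ...     | refl = proj₁ (proj₂ (one u))

  vee-hat : SubCIso (vee 𝒢 Ĝ) G
  vee-hat = record
    { from = inj₁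
    ; from-mem = λ v → c v , attached-free v
    ; from-inj = λ _ _ → inj₁-injective
    ; from-surj = λ { w (j , f , base↦w , _) →
        let u , _ , base↦u = copy-is-attached f in u , trans (sym base↦u) base↦w }
    ; adj = λ u v → ⇔-id _
    ; col = colour⇔free-copy
    }

lemma4p7 : ∀ {k : ℕ} (𝒢 : ℕ → PGraph) → GoodFamily 𝒢 →
    ((G : CGraph k) (hG : InCStar 𝒢 G) →
      SubCIso (vee 𝒢 (hat 𝒢 G (InCStar.oneColor hG))) G)
    × ((G H : CGraph k) (hG : InCStar 𝒢 G) (hH : InCStar 𝒢 H) →
      Iso (hat 𝒢 G (InCStar.oneColor hG)) (hat 𝒢 H (InCStar.oneColor hH)) →
      CIso G H)
lemma4p7 {k} 𝒢 good = vee-hat , λ G H hG hH φ → vee-iso⇒CIso 𝒢 φ (vee-hat G hG) (vee-hat H hH)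
  where
  vee-hat : (G : CGraph k) (hG : InCStar 𝒢 G) → SubCIso (vee 𝒢 (hat 𝒢 G (InCStar.oneColor hG))) G
  vee-hat = HatStructure.vee-hat 𝒢 good
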